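{- Let $\mathcal{C}\subseteq\mathbb{N}^N$ be very full and closed under addition and under componentwise maximum $\oplus$. Assume there is a group $G$ of permutations of $N$, acting transitively on $N$, such that for every $\pi\in G$ the coordinate permutation $a\mapsto a'$ with $a'_{\pi(i)}=a_i$ maps $\mathcal{C}$ onto itself. Then every $\oplus$-automorphism of $\mathcal{C}$ is permutational.
   Context: $N$ is a finite set, $\mathbb{N}=\{0,1,2,\dots\}$, $e_i$ are the canonical basis vectors, $\mathbf{1}=\sum_ie_i$, $(u\oplus v)_i=\max(u_i,v_i)$. $S\subseteq\mathbb{R}^N$ is very full if $\mathbf{1}\pm e_i\in S$ for all $i$. A $\oplus$-automorphism of $\mathcal{C}$ is a bijection $\phi:\mathcal{C}\to\mathcal{C}$ with $\phi(u\oplus v)=\phi(u)\oplus\phi(v)$. A bijection $\phi:\mathcal{C}\to\mathcal{C}$ is permutational if there is a permutation $\pi$ of $N$ with $\phi(a)_{\pi(i)}=a_i$ for all $a\in\mathcal{C}$, $i\in N$. -}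

module Defs where

open import Data.Nat using (ℕ; _+_; _⊔_)
open import Data.Fin using (Fin)
open import Data.Vec using (Vec; zipWith; replicate; updateAt; lookup; tabulate)
open import Data.Fin.Permutation using (Permutation′; _⟨$⟩ʳ_; _⟨$⟩ˡ_; id; flip; _∘ₚ_)
open import Data.Product using (Σ; ∃; ∃-syntax; _×_)
open import Relation.Binary.PropositionalEquality using (_≡_)
open import Level using (Level; _⊔_) renaming (suc to lsuc)

-- We take N = Fin n, and ℕ^N = Vec ℕ n (coordinate i is  lookup a i).
-- A subset 𝒞 ⊆ ℕ^N is a predicate  C : Vec ℕ n → Set.

module _ {n : ℕ} where

  _⊕_ : Vec ℕ n → Vec ℕ n → Vec ℕ n
  _⊕_ = zipWith Data.Nat._⊔_

  _+ᵥ_ : Vec ℕ n → Vec ℕ n → Vec ℕ n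
  _+ᵥ_ = zipWith _+_

  𝟏 : Vec ℕ n
  𝟏 = replicate n 1

  𝟏+e : Fin n → Vec ℕ n
  𝟏+e i = updateAt 𝟏 i (λ _ → 2)

  𝟏-e : Fin n → Vec ℕ n
  𝟏-e i = updateAt 𝟏 i (λ _ → 0)

  VeryFull : ∀ {ℓ} → (Vec ℕ n → Set ℓ) → Set ℓ
  VeryFull C = ∀ i → C (𝟏+e i) × C (𝟏-e i)

  AddClosed : ∀ {ℓ} → (Vec ℕ n → Set ℓ) → Set ℓ
  AddClosed C = ∀ a b → C a → C b → C (a +ᵥ b)

  MaxClosed : ∀ {ℓ} → (Vec ℕ n → Set ℓ) → Set ℓ
  MaxClosed C = ∀ a b → C a → C b → C (a ⊕ b)

  -- coordinate permutation a ↦ a' with  a'_{π(i)} = a_i,  i.e.  a'_j = a_{π⁻¹(j)}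
  permuteCoords : Permutation′ n → Vec ℕ n → Vec ℕ n
  permuteCoords π a = tabulate (λ j → lookup a (π ⟨$⟩ˡ j))

  record IsPermGroup {ℓ} (G : Permutation′ n → Set ℓ) : Set ℓ where
    field
      id-mem   : G id
      ∘-mem    : ∀ π σ → G π → G σ → G (π ∘ₚ σ)
      inv-mem  : ∀ π → G π → G (flip π)

  Transitive : ∀ {ℓ} → (Permutation′ n → Set ℓ) → Set ℓ
  Transitive G = ∀ i j → ∃[ π ] (G π × π ⟨$⟩ʳ i ≡ j)

  MapsOnto : ∀ {ℓ} → (Vec ℕ n → Set ℓ) → Permutation′ n → Set ℓ
  MapsOnto C π = (∀ a → C a → C (permuteCoords π a))
               × (∀ b → C b → Σ (Vec ℕ n) λ a → C a × permuteCoords π a ≡ b)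

  -- A ⊕-automorphism of C.  A map C → C is given as a function on pairs
  -- (a , proof that a ∈ C) whose value does not depend on the proof.
  record ⊕-Automorphism {ℓ} (C : Vec ℕ n → Set ℓ) : Set ℓ where
    field
      φ      : (a : Vec ℕ n) → C a → Vec ℕ n
      φ-wd   : ∀ a (p q : C a) → φ a p ≡ φ a q
      φ-mem  : ∀ a (p : C a) → C (φ a p)
      φ-inj  : ∀ a b (p : C a) (q : C b) → φ a p ≡ φ b q → a ≡ b
      φ-surj : ∀ b → C b → Σ (Vec ℕ n) λ a → Σ (C a) λ p → φ a p ≡ b
      φ-hom  : ∀ a b (p : C a) (q : C b) (r : C (a ⊕ b)) →
               φ (a ⊕ b) r ≡ φ a p ⊕ φ b q

  Permutational : ∀ {ℓ} {C : Vec ℕ n → Set ℓ} → ⊕-Automorphism C → Set ℓ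
  Permutational {C = C} Φ =
    ∃[ π ] (∀ a (p : C a) i → lookup (⊕-Automorphism.φ Φ a p) (π ⟨$⟩ʳ i) ≡ lookup a i)

{-# OPTIONS --safe #-}
-- A ⊕-automorphism of C is an order automorphism for the pointwise order, and it suffices to
-- treat those.  The vectors dip i M (0 at coordinate i, M + 1 elsewhere) lie in C.  A pigeonhole
-- argument shows that the image of dip i 0 vanishes at some coordinate σ i, and then, using the
-- inverse, that every dip i M is mapped to a vector vanishing at σ i and conversely.  Comparing x
-- with a ⊕ dip i M for large M shows that the (σ i)-th coordinate of the image of a is a
-- monotone function of aᵢ alone.  Transitivity of G makes all
-- coordinates of C take the same set of values, so this monotone bijection of values is the
-- identity, by well-founded induction on the value.  Hence φ(a) at σ i is aᵢ, and σ is a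
-- permutation since the same holds for the inverse.
module Submission where

open import Defs
open import Data.Nat using (ℕ; zero; suc; _+_; _⊔_; _≤_; _<_; z≤n; s≤s)
open import Data.Nat.Properties
  using (module ≤-Reasoning; ≤-refl; ≤-trans; ≤-antisym; ≤-<-trans; <-irrefl; n<1+n; ≰⇒>; n≤0⇒n≡0; n≮0;
         m≤m+n; m≤n+m; m≤n⇒m≤1+n; m≤m⊔n; m≤n⊔m; ⊔-lub; m≤n⇒m⊔n≡n; ⊔-identityʳ;
         +-comm; _≤?_)
  renaming (_≟_ to _≟ℕ_)
open import Data.Nat.Induction using (<-rec)
open import Data.Vec using (Vec; _∷_; lookup; replicate; updateAt; sum)
open import Data.Vec.Properties using (lookup-zipWith; lookup∘tabulate; lookup∘updateAt; lookup∘updateAt′; lookup-replicate)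
open import Data.Vec.Relation.Binary.Pointwise.Extensional as Pw using (Pointwise; ext; Pointwise-≡⇒≡)
open Pointwise using (app)
open import Data.Fin using (Fin; punchOut; _≟_)
open import Data.Fin.Properties using (any?; ¬∀⟶∃¬; punchOut-injective; <⇒notInjective)
open import Data.Fin.Permutation using (Permutation′; _⟨$⟩ʳ_; _⟨$⟩ˡ_; permutation; inverseˡ)
open import Data.Product using (Σ; ∃; ∃-syntax; _×_; _,_; proj₁; proj₂)
open import Data.Empty using (⊥-elim)
open import Function using (_∘_)
open import Function.Definitions using (Injective)
open import Relation.Nullary using (¬_; yes; no)
open import Relation.Nullary.Decidable using (decidable-stable)
open import Relation.Binary.PropositionalEquality using (_≡_; _≢_; refl; sym; trans; cong; subst; subst₂; cong₂; module ≡-Reasoning)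

lookup≤sum : ∀ {n} (v : Vec ℕ n) k → lookup v k ≤ sum v
lookup≤sum (x ∷ xs) Fin.zero    = m≤m+n x (sum xs)
lookup≤sum (x ∷ xs) (Fin.suc k) = ≤-trans (lookup≤sum xs k) (m≤n+m (sum xs) x)

avoiding⇒¬injective : ∀ {n} (i : Fin n) (h : Fin n → Fin n) → (∀ l → h l ≢ i) → ¬ Injective _≡_ _≡_ h
avoiding⇒¬injective {suc m} i h avoids h-injective =
  <⇒notInjective {f = h′} (n<1+n m) λ {l} {l′} eq →
    h-injective (punchOut-injective (avoids l ∘ sym) (avoids l′ ∘ sym) eq)
  where
  h′ : Fin (suc m) → Fin m
  h′ l = punchOut (avoids l ∘ sym)

module _ {n : ℕ} where

  infix 4 _≤ᵥ_
  _≤ᵥ_ : Vec ℕ n → Vec ℕ n → Set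
  _≤ᵥ_ = Pointwise _≤_

  ≤ᵥ-trans : ∀ {a b c} → a ≤ᵥ b → b ≤ᵥ c → a ≤ᵥ c
  ≤ᵥ-trans = Pw.trans ≤-trans

  lookup-⊕ : ∀ (a b : Vec ℕ n) k → lookup (a ⊕ b) k ≡ lookup a k ⊔ lookup b k
  lookup-⊕ a b k = lookup-zipWith _⊔_ k a b

  ≤ᵥ-⊕ˡ : ∀ a b → a ≤ᵥ a ⊕ b
  ≤ᵥ-⊕ˡ a b = ext λ k → subst (lookup a k ≤_) (sym (lookup-⊕ a b k)) (m≤m⊔n _ _)

  ≤ᵥ-⊕ʳ : ∀ a b → b ≤ᵥ a ⊕ b
  ≤ᵥ-⊕ʳ a b = ext λ k → subst (lookup b k ≤_) (sym (lookup-⊕ a b k)) (m≤n⊔m _ _)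

  ⊕-lub : ∀ {a b c} → a ≤ᵥ c → b ≤ᵥ c → a ⊕ b ≤ᵥ c
  ⊕-lub {a} {b} a≤c b≤c = ext λ k → subst (_≤ _) (sym (lookup-⊕ a b k)) (⊔-lub (app a≤c k) (app b≤c k))

  ≤ᵥ⇒⊕≡ : ∀ {a b} → a ≤ᵥ b → a ⊕ b ≡ b
  ≤ᵥ⇒⊕≡ {a} {b} a≤b = Pointwise-≡⇒≡ (ext λ k → trans (lookup-⊕ a b k) (m≤n⇒m⊔n≡n (app a≤b k)))

  ⊕≡⇒≤ᵥ : ∀ {a b} → a ⊕ b ≡ b → a ≤ᵥ b
  ⊕≡⇒≤ᵥ {a} {b} eq = subst (a ≤ᵥ_) eq (≤ᵥ-⊕ˡ a b)

  -- dip i 0 is 𝟏-e i.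
  dip : Fin n → ℕ → Vec ℕ n
  dip i m = updateAt (replicate n (suc m)) i (λ _ → 0)

  lookup-dip-self : ∀ i m → lookup (dip i m) i ≡ 0
  lookup-dip-self i m = lookup∘updateAt i (replicate n (suc m))

  lookup-dip-other : ∀ {i k} m → k ≢ i → lookup (dip i m) k ≡ suc m
  lookup-dip-other {i} {k} m k≢i =
    trans (lookup∘updateAt′ k i k≢i (replicate n (suc m))) (lookup-replicate k (suc m))

  lookup-dip≡0⇒≡ : ∀ {i k} m → lookup (dip i m) k ≡ 0 → k ≡ i
  lookup-dip≡0⇒≡ {i} {k} m eq with k ≟ i
  ... | yes k≡i = k≡i
  ... | no k≢i with () ← trans (sym (lookup-dip-other m k≢i)) eq

  dip-suc : ∀ i m → dip i (suc m) ≡ dip i m +ᵥ dip i 0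
  dip-suc i m = Pointwise-≡⇒≡ (ext λ k → trans (lookup-dip k) (sym (lookup-zipWith _+_ k (dip i m) (dip i 0))))
    where
    lookup-dip : ∀ k → lookup (dip i (suc m)) k ≡ lookup (dip i m) k + lookup (dip i 0) k
    lookup-dip k with k ≟ i
    ... | yes refl rewrite lookup-dip-self k (suc m) | lookup-dip-self k m | lookup-dip-self k 0 = refl
    ... | no k≢i rewrite lookup-dip-other (suc m) k≢i | lookup-dip-other m k≢i | lookup-dip-other 0 k≢i =
      cong suc (+-comm 1 m)

  dip-mono : ∀ i {m m′} → m ≤ m′ → dip i m ≤ᵥ dip i m′
  dip-mono i {m} {m′} m≤m′ = ext lookup-mono
    where
    lookup-mono : ∀ k → lookup (dip i m) k ≤ lookup (dip i m′) k
    lookup-mono k with k ≟ i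
    ... | yes refl rewrite lookup-dip-self k m = z≤n
    ... | no k≢i rewrite lookup-dip-other m k≢i | lookup-dip-other m′ k≢i = s≤s m≤m′

  lookup≤lookup-dip : ∀ c {l K k} → sum c ≤ K → k ≢ l → lookup c k ≤ lookup (dip l K) k
  lookup≤lookup-dip c {l} {K} {k} c≤K k≢l =
    subst (lookup c k ≤_) (sym (lookup-dip-other K k≢l)) (m≤n⇒m≤1+n (≤-trans (lookup≤sum c k) c≤K))

  ≤ᵥ-dip : ∀ {c l K} → lookup c l ≡ 0 → sum c ≤ K → c ≤ᵥ dip l K
  ≤ᵥ-dip {c} {l} {K} cₗ≡0 c≤K = ext below
    where
    below : ∀ k → lookup c k ≤ lookup (dip l K) k
    below k with k ≟ l
    ... | yes refl = subst (_≤ _) (sym cₗ≡0) z≤n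
    ... | no k≢l = lookup≤lookup-dip c c≤K k≢l

  ≤ᵥ-dip⊕dip : ∀ c {l l′ K} → l ≢ l′ → sum c ≤ K → c ≤ᵥ dip l K ⊕ dip l′ K
  ≤ᵥ-dip⊕dip c {l} {l′} {K} l≢l′ c≤K = ext below
    where
    below : ∀ k → lookup c k ≤ lookup (dip l K ⊕ dip l′ K) k
    below k with k ≟ l
    ... | yes refl = ≤-trans (lookup≤lookup-dip c c≤K l≢l′) (app (≤ᵥ-⊕ʳ (dip l K) (dip l′ K)) k)
    ... | no k≢l = ≤-trans (lookup≤lookup-dip c c≤K k≢l) (app (≤ᵥ-⊕ˡ (dip l K) (dip l′ K)) k)

  ≤ᵥ-⊕dip : ∀ {x a i M} → lookup x i ≤ lookup a i → sum x ≤ M → x ≤ᵥ a ⊕ dip i M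
  ≤ᵥ-⊕dip {x} {a} {i} {M} xᵢ≤aᵢ x≤M = ext below
    where
    below : ∀ k → lookup x k ≤ lookup (a ⊕ dip i M) k
    below k with k ≟ i
    ... | yes refl = ≤-trans xᵢ≤aᵢ (app (≤ᵥ-⊕ˡ a (dip i M)) k)
    ... | no k≢i = ≤-trans (lookup≤lookup-dip x x≤M k≢i) (app (≤ᵥ-⊕ʳ a (dip i M)) k)

  dip-∈ : ∀ {C : Vec ℕ n → Set} → VeryFull C → AddClosed C → ∀ i m → C (dip i m)
  dip-∈ very-full add-closed i zero    = proj₂ (very-full i)
  dip-∈ {C} very-full add-closed i (suc m) = subst C (sym (dip-suc i m))
    (add-closed _ _ (dip-∈ very-full add-closed i m) (dip-∈ very-full add-closed i 0))

  CoordinateHomogeneous : (Vec ℕ n → Set) → Set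
  CoordinateHomogeneous C = ∀ b → C b → ∀ i j → Σ (Vec ℕ n) λ a → C a × lookup a i ≡ lookup b j

  transitive⇒coordinateHomogeneous : ∀ {C : Vec ℕ n → Set} {G : Permutation′ n → Set} →
    Transitive G → (∀ π → G π → MapsOnto C π) → CoordinateHomogeneous C
  transitive⇒coordinateHomogeneous transitive maps-onto b b∈C i j with transitive j i
  ... | π , π∈G , πj≡i = permuteCoords π b , proj₁ (maps-onto π π∈G) b b∈C ,
    trans (lookup∘tabulate _ i) (cong (lookup b) (trans (cong (π ⟨$⟩ˡ_) (sym πj≡i)) (inverseˡ π)))

module OrderAutomorphisms {n : ℕ} (C : Vec ℕ n → Set) (max-closed : MaxClosed C) where

  Elt : Set
  Elt = Σ (Vec ℕ n) C

  ⌊_⌋ : Elt → Vec ℕ n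
  ⌊_⌋ = proj₁

  _⊕ₑ_ : Elt → Elt → Elt
  (a , a∈C) ⊕ₑ (b , b∈C) = a ⊕ b , max-closed a b a∈C b∈C

  record OrderAutomorphism : Set where
    field
      to from   : Elt → Elt
      to-mono   : ∀ x y → ⌊ x ⌋ ≤ᵥ ⌊ y ⌋ → ⌊ to x ⌋ ≤ᵥ ⌊ to y ⌋
      from-mono : ∀ x y → ⌊ x ⌋ ≤ᵥ ⌊ y ⌋ → ⌊ from x ⌋ ≤ᵥ ⌊ from y ⌋
      to-from   : ∀ y → ⌊ to (from y) ⌋ ≡ ⌊ y ⌋
      from-to   : ∀ x → ⌊ from (to x) ⌋ ≡ ⌊ x ⌋

    to-reflects : ∀ x y → ⌊ to x ⌋ ≤ᵥ ⌊ to y ⌋ → ⌊ x ⌋ ≤ᵥ ⌊ y ⌋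
    to-reflects x y le = subst₂ _≤ᵥ_ (from-to x) (from-to y) (from-mono (to x) (to y) le)

    to-⊕ : ∀ x y → ⌊ to (x ⊕ₑ y) ⌋ ≤ᵥ ⌊ to x ⌋ ⊕ ⌊ to y ⌋
    to-⊕ x y = subst (⌊ to (x ⊕ₑ y) ⌋ ≤ᵥ_) (to-from z) (to-mono (x ⊕ₑ y) (from z)
      (⊕-lub (below x (≤ᵥ-⊕ˡ ⌊ to x ⌋ ⌊ to y ⌋)) (below y (≤ᵥ-⊕ʳ ⌊ to x ⌋ ⌊ to y ⌋))))
      where
      z = to x ⊕ₑ to y
      below : ∀ w → ⌊ to w ⌋ ≤ᵥ ⌊ z ⌋ → ⌊ w ⌋ ≤ᵥ ⌊ from z ⌋
      below w le = to-reflects w (from z) (subst (⌊ to w ⌋ ≤ᵥ_) (sym (to-from z)) le)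

  inverse : OrderAutomorphism → OrderAutomorphism
  inverse O = record
    { to = from ; from = to ; to-mono = from-mono ; from-mono = to-mono ; to-from = from-to ; from-to = to-from }
    where open OrderAutomorphism O

  module _ (Φ : ⊕-Automorphism C) where
    open ⊕-Automorphism Φ

    φₑ : Elt → Elt
    φₑ (a , a∈C) = φ a a∈C , φ-mem a a∈C

    φ⁻¹ₑ : Elt → Elt
    φ⁻¹ₑ (b , b∈C) = let (a , a∈C , _) = φ-surj b b∈C in a , a∈C

    φ-cong : ∀ {a b} (a∈C : C a) (b∈C : C b) → a ≡ b → φ a a∈C ≡ φ b b∈C
    φ-cong a∈C b∈C refl = φ-wd _ a∈C b∈C

    φ-φ⁻¹ : ∀ y → ⌊ φₑ (φ⁻¹ₑ y) ⌋ ≡ ⌊ y ⌋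
    φ-φ⁻¹ (b , b∈C) = proj₂ (proj₂ (φ-surj b b∈C))

    φ⁻¹-φ : ∀ x → ⌊ φ⁻¹ₑ (φₑ x) ⌋ ≡ ⌊ x ⌋
    φ⁻¹-φ x = φ-inj _ _ _ _ (φ-φ⁻¹ (φₑ x))

    φ-mono : ∀ x y → ⌊ x ⌋ ≤ᵥ ⌊ y ⌋ → ⌊ φₑ x ⌋ ≤ᵥ ⌊ φₑ y ⌋
    φ-mono (a , a∈C) (b , b∈C) a≤b = ⊕≡⇒≤ᵥ (begin
      φ a a∈C ⊕ φ b b∈C  ≡⟨ φ-hom a b a∈C b∈C a⊕b∈C ⟨
      φ (a ⊕ b) a⊕b∈C     ≡⟨ φ-cong a⊕b∈C b∈C (≤ᵥ⇒⊕≡ a≤b) ⟩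
      φ b b∈C             ∎)
      where
      open ≡-Reasoning
      a⊕b∈C = max-closed a b a∈C b∈C

    φ⁻¹-mono : ∀ x y → ⌊ x ⌋ ≤ᵥ ⌊ y ⌋ → ⌊ φ⁻¹ₑ x ⌋ ≤ᵥ ⌊ φ⁻¹ₑ y ⌋
    φ⁻¹-mono x y x≤y = ⊕≡⇒≤ᵥ (φ-inj _ _ a⊕b∈C b∈C (begin
      φ (a ⊕ b) a⊕b∈C      ≡⟨ φ-hom a b a∈C b∈C a⊕b∈C ⟩
      φ a a∈C ⊕ φ b b∈C    ≡⟨ cong₂ _⊕_ (φ-φ⁻¹ x) (φ-φ⁻¹ y) ⟩
      ⌊ x ⌋ ⊕ ⌊ y ⌋         ≡⟨ ≤ᵥ⇒⊕≡ x≤y ⟩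
      ⌊ y ⌋                 ≡⟨ φ-φ⁻¹ y ⟨
      φ b b∈C              ∎))
      where
      open ≡-Reasoning
      a = ⌊ φ⁻¹ₑ x ⌋
      b = ⌊ φ⁻¹ₑ y ⌋
      a∈C = proj₂ (φ⁻¹ₑ x)
      b∈C = proj₂ (φ⁻¹ₑ y)
      a⊕b∈C = max-closed a b a∈C b∈C

    ⊕-Automorphism⇒OrderAutomorphism : OrderAutomorphism
    ⊕-Automorphism⇒OrderAutomorphism = record
      { to = φₑ ; from = φ⁻¹ₑ ; to-mono = φ-mono ; from-mono = φ⁻¹-mono ; to-from = φ-φ⁻¹ ; from-to = φ⁻¹-φ }

module Rigidity {n : ℕ} (C : Vec ℕ n → Set) (very-full : VeryFull C) (add-closed : AddClosed C)
                (max-closed : MaxClosed C) where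

  open OrderAutomorphisms C max-closed
  open OrderAutomorphism

  dipₑ : Fin n → ℕ → Elt
  dipₑ i m = dip i m , dip-∈ very-full add-closed i m

  module _ (O : OrderAutomorphism) where

    below-from-dip⇒to-zero : ∀ x l K → ⌊ x ⌋ ≤ᵥ ⌊ from O (dipₑ l K) ⌋ → lookup ⌊ to O x ⌋ l ≡ 0
    below-from-dip⇒to-zero x l K le = n≤0⇒n≡0 (subst (lookup ⌊ to O x ⌋ l ≤_)
      (trans (cong (λ v → lookup v l) (to-from O (dipₑ l K))) (lookup-dip-self l K))
      (app (to-mono O x (from O (dipₑ l K)) le) l))

    below-from-dip⊕from-dip : ∀ x {l l′} K → l ≢ l′ → sum ⌊ to O x ⌋ ≤ K →
      ⌊ x ⌋ ≤ᵥ ⌊ from O (dipₑ l K) ⊕ₑ from O (dipₑ l′ K) ⌋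
    below-from-dip⊕from-dip x {l} {l′} K l≢l′ x≤K = to-reflects O x e
      (≤ᵥ-trans (≤ᵥ-dip⊕dip ⌊ to O x ⌋ l≢l′ x≤K) (⊕-lub
        (dip-below-to-e (≤ᵥ-⊕ˡ ⌊ from O (dipₑ l K) ⌋ ⌊ from O (dipₑ l′ K) ⌋))
        (dip-below-to-e (≤ᵥ-⊕ʳ ⌊ from O (dipₑ l K) ⌋ ⌊ from O (dipₑ l′ K) ⌋))))
      where
      e = from O (dipₑ l K) ⊕ₑ from O (dipₑ l′ K)
      dip-below-to-e : ∀ {l} → ⌊ from O (dipₑ l K) ⌋ ≤ᵥ ⌊ e ⌋ → dip l K ≤ᵥ ⌊ to O e ⌋
      dip-below-to-e {l} le = subst (_≤ᵥ ⌊ to O e ⌋) (to-from O (dipₑ l K)) (to-mono O _ e le)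

    -- If the image c of dip i m had no zero, then with K = sum c no from (dip l K) could lie above
    -- dip i m; choosing for each l a coordinate where it falls short gives a map avoiding i,
    -- and two l sharing that coordinate contradict below-from-dip⊕from-dip.
    image-dip-has-zero : ∀ i m → ∃ λ k → lookup ⌊ to O (dipₑ i m) ⌋ k ≡ 0
    image-dip-has-zero i m = decidable-stable (any? λ k → lookup c k ≟ℕ 0) no-zero-impossible
      where
      c = ⌊ to O (dipₑ i m) ⌋
      K = sum c
      d : Fin n → Vec ℕ n
      d l = ⌊ from O (dipₑ l K) ⌋

      no-zero-impossible : ¬ ¬ ∃ λ k → lookup c k ≡ 0
      no-zero-impossible no-zero = avoiding⇒¬injective i escape escape≢i escape-injective
        where
        escapes : ∀ l → ∃ λ k → lookup (d l) k < lookup (dip i m) k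
        escapes l =
          let k , dipₖ≰dₖ = ¬∀⟶∃¬ n _ (λ k → lookup (dip i m) k ≤? lookup (d l) k)
                                      (λ le → no-zero (l , below-from-dip⇒to-zero (dipₑ i m) l K (ext le)))
          in k , ≰⇒> dipₖ≰dₖ

        escape : Fin n → Fin n
        escape = proj₁ ∘ escapes

        escape≢i : ∀ l → escape l ≢ i
        escape≢i l eq = n≮0 (subst (lookup (d l) i <_) (lookup-dip-self i m)
          (subst (λ k → lookup (d l) k < lookup (dip i m) k) eq (proj₂ (escapes l))))

        escape-injective : Injective _≡_ _≡_ escape
        escape-injective {l} {l′} same with l ≟ l′
        ... | yes l≡l′ = l≡l′
        ... | no l≢l′ = ⊥-elim (<-irrefl refl (≤-<-trans dipₖ≤ (⊔-lub (proj₂ (escapes l))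
                          (subst (λ k → lookup (d l′) k < lookup (dip i m) k) (sym same) (proj₂ (escapes l′))))))
          where
          k = escape l
          dipₖ≤ : lookup (dip i m) k ≤ lookup (d l) k ⊔ lookup (d l′) k
          dipₖ≤ = subst (lookup (dip i m) k ≤_) (lookup-⊕ (d l) (d l′) k)
            (app (below-from-dip⊕from-dip (dipₑ i m) K l≢l′ ≤-refl) k)

  Corresponds : OrderAutomorphism → Fin n → Fin n → Set
  Corresponds O i j = ∀ M → lookup ⌊ to O (dipₑ i M) ⌋ j ≡ 0

  zero⇒inverse-corresponds : ∀ O i j → lookup ⌊ to O (dipₑ i 0) ⌋ j ≡ 0 → Corresponds (inverse O) j i
  zero⇒inverse-corresponds O i j cⱼ≡0 M = n≤0⇒n≡0 (subst (lookup ⌊ from O (dipₑ j M) ⌋ i ≤_) zero-at-i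
    (app (from-mono O (dipₑ j M) (dipₑ j K) (dip-mono j (m≤m+n M (sum c)))) i))
    where
    c = ⌊ to O (dipₑ i 0) ⌋
    K = M + sum c
    above : dip i 0 ≤ᵥ ⌊ from O (dipₑ j K) ⌋
    above = to-reflects O (dipₑ i 0) (from O (dipₑ j K))
      (subst (c ≤ᵥ_) (sym (to-from O (dipₑ j K))) (≤ᵥ-dip cⱼ≡0 (m≤n+m (sum c) M)))
    zero-at-i : lookup ⌊ from O (dipₑ j K) ⌋ i ≡ 0
    zero-at-i =
      let q , zero-at-q = image-dip-has-zero (inverse O) j K
          q≡i = lookup-dip≡0⇒≡ 0 (n≤0⇒n≡0 (subst (lookup (dip i 0) q ≤_) zero-at-q (app above q)))
      in subst (λ k → lookup ⌊ from O (dipₑ j K) ⌋ k ≡ 0) q≡i zero-at-q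

  corresponds⇒mono : ∀ O {i j} → Corresponds O i j → ∀ x a →
    lookup ⌊ x ⌋ i ≤ lookup ⌊ a ⌋ i → lookup ⌊ to O x ⌋ j ≤ lookup ⌊ to O a ⌋ j
  corresponds⇒mono O {i} {j} corr x a xᵢ≤aᵢ = begin
    lookup ⌊ to O x ⌋ j                              ≤⟨ app (to-mono O x (a ⊕ₑ d) (≤ᵥ-⊕dip xᵢ≤aᵢ ≤-refl)) j ⟩
    lookup ⌊ to O (a ⊕ₑ d) ⌋ j                       ≤⟨ app (to-⊕ O a d) j ⟩
    lookup (⌊ to O a ⌋ ⊕ ⌊ to O d ⌋) j               ≡⟨ lookup-⊕ ⌊ to O a ⌋ ⌊ to O d ⌋ j ⟩
    lookup ⌊ to O a ⌋ j ⊔ lookup ⌊ to O d ⌋ j        ≡⟨ cong (lookup ⌊ to O a ⌋ j ⊔_) (corr (sum ⌊ x ⌋)) ⟩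
    lookup ⌊ to O a ⌋ j ⊔ 0                          ≡⟨ ⊔-identityʳ _ ⟩
    lookup ⌊ to O a ⌋ j                              ∎
    where
    open ≤-Reasoning
    d = dipₑ i (sum ⌊ x ⌋)

  module _ (homogeneous : CoordinateHomogeneous C) where

    -- If some a had to(a)ⱼ < aᵢ, homogeneity provides a′ with a′ᵢ = to(a)ⱼ; the induction
    -- hypothesis for a′ and monotonicity of from along the correspondence give aᵢ ≤ a′ᵢ.
    corresponds⇒≤ : ∀ O {i j} → Corresponds O i j → Corresponds (inverse O) j i →
      ∀ a → lookup ⌊ a ⌋ i ≤ lookup ⌊ to O a ⌋ j
    corresponds⇒≤ O {i} {j} corr corr⁻¹ a = <-rec P step (lookup ⌊ a ⌋ i) a refl
      where
      P : ℕ → Set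
      P v = ∀ a → lookup ⌊ a ⌋ i ≡ v → lookup ⌊ a ⌋ i ≤ lookup ⌊ to O a ⌋ j

      step : ∀ v → (∀ {u} → u < v → P u) → P v
      step _ rec a refl with lookup ⌊ a ⌋ i ≤? lookup ⌊ to O a ⌋ j | homogeneous ⌊ to O a ⌋ (proj₂ (to O a)) i j
      ... | yes aᵢ≤ | _ = aᵢ≤
      ... | no aᵢ≰ | a′ , a′∈C , a′ᵢ≡ = ⊥-elim (<-irrefl refl (≤-<-trans aᵢ≤a′ᵢ a′ᵢ<aᵢ))
        where
        a′ᵢ<aᵢ : lookup a′ i < lookup ⌊ a ⌋ i
        a′ᵢ<aᵢ = subst (_< lookup ⌊ a ⌋ i) (sym a′ᵢ≡) (≰⇒> aᵢ≰)
        to-a≤to-a′ : lookup ⌊ to O a ⌋ j ≤ lookup ⌊ to O (a′ , a′∈C) ⌋ j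
        to-a≤to-a′ = subst (_≤ lookup ⌊ to O (a′ , a′∈C) ⌋ j) a′ᵢ≡ (rec a′ᵢ<aᵢ (a′ , a′∈C) refl)
        aᵢ≤a′ᵢ : lookup ⌊ a ⌋ i ≤ lookup a′ i
        aᵢ≤a′ᵢ = subst₂ (λ u w → lookup u i ≤ lookup w i) (from-to O a) (from-to O (a′ , a′∈C))
          (corresponds⇒mono (inverse O) corr⁻¹ (to O a) (to O (a′ , a′∈C)) to-a≤to-a′)

    partner : OrderAutomorphism → Fin n → Fin n
    partner O i = proj₁ (image-dip-has-zero O i 0)

    partner-corresponds⁻¹ : ∀ O i → Corresponds (inverse O) (partner O i) i
    partner-corresponds⁻¹ O i = zero⇒inverse-corresponds O i (partner O i) (proj₂ (image-dip-has-zero O i 0))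

    partner-corresponds : ∀ O i → Corresponds O i (partner O i)
    partner-corresponds O i =
      zero⇒inverse-corresponds (inverse O) (partner O i) i (partner-corresponds⁻¹ O i 0)

    lookup-partner : ∀ O i a → lookup ⌊ to O a ⌋ (partner O i) ≡ lookup ⌊ a ⌋ i
    lookup-partner O i a = ≤-antisym
      (subst (λ u → lookup ⌊ to O a ⌋ (partner O i) ≤ lookup u i) (from-to O a)
        (corresponds⇒≤ (inverse O) (partner-corresponds⁻¹ O i) (partner-corresponds O i) (to O a)))
      (corresponds⇒≤ O (partner-corresponds O i) (partner-corresponds⁻¹ O i) a)

    partner-inverse : ∀ O j → partner O (partner (inverse O) j) ≡ j
    partner-inverse O j = lookup-dip≡0⇒≡ 0 (begin
      lookup (dip j 0) k                            ≡⟨ cong (λ v → lookup v k) (to-from O (dipₑ j 0)) ⟨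
      lookup ⌊ to O (from O (dipₑ j 0)) ⌋ k         ≡⟨ lookup-partner O q (from O (dipₑ j 0)) ⟩
      lookup ⌊ from O (dipₑ j 0) ⌋ q                ≡⟨ lookup-partner (inverse O) j (dipₑ j 0) ⟩
      lookup (dip j 0) j                            ≡⟨ lookup-dip-self j 0 ⟩
      0                                             ∎)
      where
      open ≡-Reasoning
      q = partner (inverse O) j
      k = partner O q

    orderAutomorphism-permutational : ∀ O →
      ∃[ π ] (∀ a (a∈C : C a) i → lookup ⌊ to O (a , a∈C) ⌋ (π ⟨$⟩ʳ i) ≡ lookup a i)
    orderAutomorphism-permutational O =
      permutation (partner O) (partner (inverse O)) (partner-inverse O) (partner-inverse (inverse O)) ,
      λ a a∈C i → lookup-partner O i (a , a∈C)

mainTheorem18 : (n : ℕ) (C : Vec ℕ n → Set) →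
    VeryFull C → AddClosed C → MaxClosed C →
    (G : Permutation′ n → Set) → IsPermGroup G → Transitive G →
    (∀ π → G π → MapsOnto C π) →
    (Φ : ⊕-Automorphism C) → Permutational Φ
mainTheorem18 n C very-full add-closed max-closed G _ transitive maps-onto Φ =
  Rigidity.orderAutomorphism-permutational C very-full add-closed max-closed
    (transitive⇒coordinateHomogeneous transitive maps-onto)
    (OrderAutomorphisms.⊕-Automorphism⇒OrderAutomorphism C max-closed Φ)
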